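{- $\mathrm{E\text{ - }HA}^{\omega*}_{\mathrm{st}}+\mathrm{R}+\mathrm{HGMP}\vdash\mathrm{US}$.
   Context: Finite types: $0$, $\sigma\to\tau$, $\sigma^*$ (finite sequences). $\mathcal T^*$: Gödel's T extended with $\varepsilon_\sigma$, prepending $c$, list recursors. $\mathrm{E\text{ - }HA}^{\omega*}$: intuitionistic extensional arithmetic in these types over $\mathcal T^*$ with full induction and $\forall y^{\sigma^*}(y=\varepsilon\lor\exists a,x\,y=c(a,x))$. $s\in t:\equiv\exists i<|t|(s=(t)_i)$. $\mathrm{E\text{ - }HA}^{\omega*}_{\mathrm{st}}$: add predicates $\mathrm{st}^\sigma$, quantifiers $\forall^{\mathrm{st}},\exists^{\mathrm{st}}$ (formulas without these are internal; lower-case Greek letters denote internal formulas, possibly with parameters), axioms $\forall^{\mathrm{st}}x\Phi\leftrightarrow\forall x(\mathrm{st}(x)\to\Phi)$, $\exists^{\mathrm{st}}x\Phi\leftrightarrow\exists x(\mathrm{st}(x)\land\Phi)$, $\mathrm{st}(x)\land x=y\to\mathrm{st}(y)$, $\mathrm{st}(t)$ for closed $t\in\mathcal T^*$, $\mathrm{st}(f)\land\mathrm{st}(x)\to\mathrm{st}(fx)$, external induction for all formulas; internal induction only for internal formulas; intuitionistic logic. $\mathrm{R}$: $\forall y^\tau\exists^{\mathrm{st}}x^\sigma\varphi(x,y)\to\exists^{\mathrm{st}}x^{\sigma^*}\forall y^\tau\exists x'\in x\,\varphi(x',y)$. $\mathrm{HGMP}$: $(\forall^{\mathrm{st}}x\varphi(x)\to\psi)\to\exists^{\mathrm{st}}x(\forall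 x'\in x\,\varphi(x')\to\psi)$. $\mathrm{US}$: $\forall x^\sigma(\neg\mathrm{st}(x)\to\varphi(x))\to\exists^{\mathrm{st}}x^\sigma\varphi(x)$ (all types). -}

module Defs where

open import Data.List using (List; []; _∷_; map)
open import Data.List.Membership.Propositional using (_∈_)
open import Data.Empty using (⊥)
open import Data.Unit using (⊤)
open import Data.Product using (_×_)

infixr 7 _⇒_
data Ty : Set where
  𝕆   : Ty
  _⇒_ : Ty → Ty → Ty
  Seq : Ty → Ty

Ctx : Set
Ctx = List Ty

data Var : Ctx → Ty → Set where
  vz : ∀ {Γ σ} → Var (σ ∷ Γ) σ
  vs : ∀ {Γ σ τ} → Var Γ σ → Var (τ ∷ Γ) σ

data Tm (Γ : Ctx) : Ty → Set where
  var  : ∀ {σ} → Var Γ σ → Tm Γ σ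
  lam  : ∀ {σ τ} → Tm (σ ∷ Γ) τ → Tm Γ (σ ⇒ τ)
  app  : ∀ {σ τ} → Tm Γ (σ ⇒ τ) → Tm Γ σ → Tm Γ τ
  zer  : Tm Γ 𝕆
  suc  : Tm Γ (𝕆 ⇒ 𝕆)
  rec  : ∀ σ → Tm Γ (σ ⇒ (σ ⇒ 𝕆 ⇒ σ) ⇒ 𝕆 ⇒ σ)
  nil  : ∀ σ → Tm Γ (Seq σ)
  cons : ∀ σ → Tm Γ (σ ⇒ Seq σ ⇒ Seq σ)
  lrec : ∀ σ τ → Tm Γ (τ ⇒ (σ ⇒ Seq σ ⇒ τ ⇒ τ) ⇒ Seq σ ⇒ τ)

Ren : Ctx → Ctx → Set
Ren Γ Δ = ∀ {σ} → Var Γ σ → Var Δ σ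

liftR : ∀ {Γ Δ τ} → Ren Γ Δ → Ren (τ ∷ Γ) (τ ∷ Δ)
liftR r vz     = vz
liftR r (vs x) = vs (r x)

ren : ∀ {Γ Δ σ} → Ren Γ Δ → Tm Γ σ → Tm Δ σ
ren r (var x)    = var (r x)
ren r (lam t)    = lam (ren (liftR r) t)
ren r (app t u)  = app (ren r t) (ren r u)
ren r zer        = zer
ren r suc        = suc
ren r (rec σ)    = rec σ
ren r (nil σ)    = nil σ
ren r (cons σ)   = cons σ
ren r (lrec σ τ) = lrec σ τ

Sub : Ctx → Ctx → Set
Sub Γ Δ = ∀ {σ} → Var Γ σ → Tm Δ σ

liftS : ∀ {Γ Δ τ} → Sub Γ Δ → Sub (τ ∷ Γ) (τ ∷ Δ)
liftS s vz     = var vz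
liftS s (vs x) = ren vs (s x)

sub : ∀ {Γ Δ σ} → Sub Γ Δ → Tm Γ σ → Tm Δ σ
sub s (var x)    = s x
sub s (lam t)    = lam (sub (liftS s) t)
sub s (app t u)  = app (sub s t) (sub s u)
sub s zer        = zer
sub s suc        = suc
sub s (rec σ)    = rec σ
sub s (nil σ)    = nil σ
sub s (cons σ)   = cons σ
sub s (lrec σ τ) = lrec σ τ

_▹_ : ∀ {Γ Δ σ} → Sub Γ Δ → Tm Δ σ → Sub (σ ∷ Γ) Δ
(s ▹ t) vz     = t
(s ▹ t) (vs x) = s x

sub0 : ∀ {Γ σ} → Tm Γ σ → Sub (σ ∷ Γ) Γ
sub0 t = var ▹ t

_[_]ₜ : ∀ {Γ σ τ} → Tm (σ ∷ Γ) τ → Tm Γ σ → Tm Γ τ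
b [ t ]ₜ = sub (sub0 t) b

wk : ∀ {Γ σ τ} → Tm Γ σ → Tm (τ ∷ Γ) σ
wk = ren vs

-- Formulas of E-HA^{ω*}_st.  Equality is primitive at all types
-- (together with the extensionality axiom below).

infixr 3 _⊃_
infixr 4 _∨'_
infixr 5 _∧'_
infix  6 _≐_

data Fm (Γ : Ctx) : Set where
  _≐_   : ∀ {σ} → Tm Γ σ → Tm Γ σ → Fm Γ
  ⊥'    : Fm Γ
  _∧'_  : Fm Γ → Fm Γ → Fm Γ
  _∨'_  : Fm Γ → Fm Γ → Fm Γ
  _⊃_   : Fm Γ → Fm Γ → Fm Γ
  all   : ∀ σ → Fm (σ ∷ Γ) → Fm Γ
  ex    : ∀ σ → Fm (σ ∷ Γ) → Fm Γ
  st    : ∀ {σ} → Tm Γ σ → Fm Γ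
  allSt : ∀ σ → Fm (σ ∷ Γ) → Fm Γ
  exSt  : ∀ σ → Fm (σ ∷ Γ) → Fm Γ

renF : ∀ {Γ Δ} → Ren Γ Δ → Fm Γ → Fm Δ
renF r (s ≐ t)     = ren r s ≐ ren r t
renF r ⊥'          = ⊥'
renF r (φ ∧' ψ)    = renF r φ ∧' renF r ψ
renF r (φ ∨' ψ)    = renF r φ ∨' renF r ψ
renF r (φ ⊃ ψ)     = renF r φ ⊃ renF r ψ
renF r (all σ φ)   = all σ (renF (liftR r) φ)
renF r (ex σ φ)    = ex σ (renF (liftR r) φ)
renF r (st t)      = st (ren r t)
renF r (allSt σ φ) = allSt σ (renF (liftR r) φ)
renF r (exSt σ φ)  = exSt σ (renF (liftR r) φ)

subF : ∀ {Γ Δ} → Sub Γ Δ → Fm Γ → Fm Δ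
subF s (t ≐ u)     = sub s t ≐ sub s u
subF s ⊥'          = ⊥'
subF s (φ ∧' ψ)    = subF s φ ∧' subF s ψ
subF s (φ ∨' ψ)    = subF s φ ∨' subF s ψ
subF s (φ ⊃ ψ)     = subF s φ ⊃ subF s ψ
subF s (all σ φ)   = all σ (subF (liftS s) φ)
subF s (ex σ φ)    = ex σ (subF (liftS s) φ)
subF s (st t)      = st (sub s t)
subF s (allSt σ φ) = allSt σ (subF (liftS s) φ)
subF s (exSt σ φ)  = exSt σ (subF (liftS s) φ)

_[_] : ∀ {Γ σ} → Fm (σ ∷ Γ) → Tm Γ σ → Fm Γ
φ [ t ] = subF (sub0 t) φ

wkF : ∀ {Γ τ} → Fm Γ → Fm (τ ∷ Γ)
wkF = renF vs

succF : ∀ {Γ} → Fm (𝕆 ∷ Γ) → Fm (𝕆 ∷ Γ)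
succF φ = subF ((λ x → var (vs x)) ▹ app suc (var vz)) φ

¬' : ∀ {Γ} → Fm Γ → Fm Γ
¬' φ = φ ⊃ ⊥'

_⇔'_ : ∀ {Γ} → Fm Γ → Fm Γ → Fm Γ
φ ⇔' ψ = (φ ⊃ ψ) ∧' (ψ ⊃ φ)

Internal : ∀ {Γ} → Fm Γ → Set
Internal (s ≐ t)     = ⊤
Internal ⊥'          = ⊤
Internal (φ ∧' ψ)    = Internal φ × Internal ψ
Internal (φ ∨' ψ)    = Internal φ × Internal ψ
Internal (φ ⊃ ψ)     = Internal φ × Internal ψ
Internal (all σ φ)   = Internal φ
Internal (ex σ φ)    = Internal φ
Internal (st t)      = ⊥
Internal (allSt σ φ) = ⊥
Internal (exSt σ φ)  = ⊥

zeroOf : ∀ {Γ} σ → Tm Γ σ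
zeroOf 𝕆       = zer
zeroOf (σ ⇒ τ) = lam (zeroOf τ)
zeroOf (Seq σ) = nil σ

plus : ∀ {Γ} → Tm Γ 𝕆 → Tm Γ 𝕆 → Tm Γ 𝕆
plus s t = app (app (app (rec 𝕆) s) (lam (lam (app suc (var (vs vz)))))) t

len : ∀ {Γ σ} → Tm Γ (Seq σ) → Tm Γ 𝕆
len {σ = σ} t =
  app (app (app (lrec σ 𝕆) zer) (lam (lam (lam (app suc (var vz)))))) t

-- (t)_i := L (λi.0^σ) (λa.λl.λr.λi. R_σ a (λu.λj. r j) i) t i
nth : ∀ {Γ σ} → Tm Γ (Seq σ) → Tm Γ 𝕆 → Tm Γ σ
nth {σ = σ} t i =
  app (app (app (app (lrec σ (𝕆 ⇒ σ)) (lam (zeroOf σ))) step) t) i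
  where
  step : ∀ {Γ} → Tm Γ (σ ⇒ Seq σ ⇒ (𝕆 ⇒ σ) ⇒ 𝕆 ⇒ σ)
  step = lam (lam (lam (lam
           (app (app (app (rec σ) (var (vs (vs (vs vz)))))
                     (lam (lam (app (var (vs (vs (vs vz)))) (var vz)))))
                (var vz)))))

lt : ∀ {Γ} → Tm Γ 𝕆 → Tm Γ 𝕆 → Fm Γ
lt s t = ex 𝕆 (plus (wk s) (app suc (var vz)) ≐ wk t)

-- the formula ψ(x') with x' replaced by (x)_i, i the new variable 0
atIndex : ∀ {Γ σ} → Tm Γ (Seq σ) → Fm (σ ∷ Γ) → Fm (𝕆 ∷ Γ)
atIndex x ψ = subF ((λ y → var (vs y)) ▹ nth (wk x) (var vz)) ψ

-- ∃x' ∈ x ψ(x')  :=  ∃i (i < |x| ∧ ψ((x)_i))      (s ∈ t ≡ ∃i<|t| s = (t)_i)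
exIn : ∀ {Γ σ} → Tm Γ (Seq σ) → Fm (σ ∷ Γ) → Fm Γ
exIn x ψ = ex 𝕆 (lt (var vz) (len (wk x)) ∧' atIndex x ψ)

allIn : ∀ {Γ σ} → Tm Γ (Seq σ) → Fm (σ ∷ Γ) → Fm Γ
allIn x ψ = all 𝕆 (lt (var vz) (len (wk x)) ⊃ atIndex x ψ)

-- Axioms of E-HA^{ω*}_st (open schematic form; universal closures
-- follow by ∀-introduction)

closeTm : ∀ {Γ σ} → Tm [] σ → Tm Γ σ
closeTm = ren (λ ())

data BaseAx {Γ : Ctx} : Fm Γ → Set where
  eqRefl   : ∀ {σ} (t : Tm Γ σ) → BaseAx (t ≐ t)
  eqSubst  : ∀ {σ} (φ : Fm (σ ∷ Γ)) → Internal φ → (s t : Tm Γ σ) →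
             BaseAx (s ≐ t ⊃ φ [ s ] ⊃ φ [ t ])
  ext      : ∀ {σ τ} (f g : Tm Γ (σ ⇒ τ)) →
             BaseAx (all σ (app (wk f) (var vz) ≐ app (wk g) (var vz)) ⊃ f ≐ g)
  beta     : ∀ {σ τ} (b : Tm (σ ∷ Γ) τ) (t : Tm Γ σ) →
             BaseAx (app (lam b) t ≐ b [ t ]ₜ)
  recZ     : ∀ {σ} (x : Tm Γ σ) (y : Tm Γ (σ ⇒ 𝕆 ⇒ σ)) →
             BaseAx (app (app (app (rec σ) x) y) zer ≐ x)
  recS     : ∀ {σ} (x : Tm Γ σ) (y : Tm Γ (σ ⇒ 𝕆 ⇒ σ)) (n : Tm Γ 𝕆) →
             BaseAx (app (app (app (rec σ) x) y) (app suc n)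
                     ≐ app (app y (app (app (app (rec σ) x) y) n)) n)
  lrecNil  : ∀ {σ τ} (x : Tm Γ τ) (y : Tm Γ (σ ⇒ Seq σ ⇒ τ ⇒ τ)) →
             BaseAx (app (app (app (lrec σ τ) x) y) (nil σ) ≐ x)
  lrecCons : ∀ {σ τ} (x : Tm Γ τ) (y : Tm Γ (σ ⇒ Seq σ ⇒ τ ⇒ τ))
               (a : Tm Γ σ) (l : Tm Γ (Seq σ)) →
             BaseAx (app (app (app (lrec σ τ) x) y) (app (app (cons σ) a) l)
                     ≐ app (app (app y a) l) (app (app (app (lrec σ τ) x) y) l))
  sucNZ    : (t : Tm Γ 𝕆) → BaseAx (¬' (app suc t ≐ zer))
  sucInj   : (s t : Tm Γ 𝕆) → BaseAx (app suc s ≐ app suc t ⊃ s ≐ t)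
  ind      : (φ : Fm (𝕆 ∷ Γ)) → Internal φ →
             BaseAx (φ [ zer ] ⊃ all 𝕆 (φ ⊃ succF φ) ⊃ all 𝕆 φ)
  seqCases : ∀ {σ} (t : Tm Γ (Seq σ)) →
             BaseAx (t ≐ nil σ ∨'
                     ex σ (ex (Seq σ) (wk (wk t) ≐ app (app (cons σ) (var (vs vz))) (var vz))))
  allStDef : ∀ {σ} (Φ : Fm (σ ∷ Γ)) → BaseAx (allSt σ Φ ⇔' all σ (st (var vz) ⊃ Φ))
  exStDef  : ∀ {σ} (Φ : Fm (σ ∷ Γ)) → BaseAx (exSt σ Φ ⇔' ex σ (st (var vz) ∧' Φ))
  stEq     : ∀ {σ} (s t : Tm Γ σ) → BaseAx (st s ∧' s ≐ t ⊃ st t)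
  stClosed : ∀ {σ} (t : Tm [] σ) → BaseAx (st (closeTm {Γ} t))
  stApp    : ∀ {σ τ} (f : Tm Γ (σ ⇒ τ)) (x : Tm Γ σ) → BaseAx (st f ∧' st x ⊃ st (app f x))
  extInd   : (Φ : Fm (𝕆 ∷ Γ)) →
             BaseAx (Φ [ zer ] ⊃ allSt 𝕆 (Φ ⊃ succF Φ) ⊃ allSt 𝕆 Φ)

-- R: ∀y^τ ∃^st x^σ φ(x,y) → ∃^st x^{σ*} ∀y^τ ∃x' ∈ x φ(x',y)
-- (φ : Fm (σ ∷ τ ∷ Γ), variable 0 is x, variable 1 is y)
R-ax : ∀ {Γ σ τ} → Fm (σ ∷ τ ∷ Γ) → Fm Γ
R-ax {σ = σ} {τ = τ} φ =
  all τ (exSt σ φ) ⊃ exSt (Seq σ) (all τ (exIn (var (vs vz)) (renF (liftR (liftR vs)) φ)))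

HGMP-ax : ∀ {Γ σ} → Fm (σ ∷ Γ) → Fm Γ → Fm Γ
HGMP-ax {σ = σ} φ ψ =
  (allSt σ φ ⊃ ψ) ⊃ exSt (Seq σ) (allIn (var vz) (renF (liftR vs) φ) ⊃ wkF ψ)

US-ax : ∀ {Γ σ} → Fm (σ ∷ Γ) → Fm Γ
US-ax {σ = σ} φ = all σ (¬' (st (var vz)) ⊃ φ) ⊃ exSt σ φ

data AxRH {Γ : Ctx} : Fm Γ → Set where
  base : ∀ {φ} → BaseAx φ → AxRH φ
  R    : ∀ {σ τ} (φ : Fm (σ ∷ τ ∷ Γ)) → Internal φ → AxRH (R-ax φ)
  HGMP : ∀ {σ} (φ : Fm (σ ∷ Γ)) (ψ : Fm Γ) → Internal φ → Internal ψ →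
         AxRH (HGMP-ax φ ψ)

data Pf (Ax : ∀ {Γ} → Fm Γ → Set) : (Γ : Ctx) → List (Fm Γ) → Fm Γ → Set where
  hyp  : ∀ {Γ Δ φ} → φ ∈ Δ → Pf Ax Γ Δ φ
  ax   : ∀ {Γ Δ φ} → Ax φ → Pf Ax Γ Δ φ
  ⊥E   : ∀ {Γ Δ φ} → Pf Ax Γ Δ ⊥' → Pf Ax Γ Δ φ
  ∧I   : ∀ {Γ Δ φ ψ} → Pf Ax Γ Δ φ → Pf Ax Γ Δ ψ → Pf Ax Γ Δ (φ ∧' ψ)
  ∧E₁  : ∀ {Γ Δ φ ψ} → Pf Ax Γ Δ (φ ∧' ψ) → Pf Ax Γ Δ φ
  ∧E₂  : ∀ {Γ Δ φ ψ} → Pf Ax Γ Δ (φ ∧' ψ) → Pf Ax Γ Δ ψ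
  ∨I₁  : ∀ {Γ Δ φ ψ} → Pf Ax Γ Δ φ → Pf Ax Γ Δ (φ ∨' ψ)
  ∨I₂  : ∀ {Γ Δ φ ψ} → Pf Ax Γ Δ ψ → Pf Ax Γ Δ (φ ∨' ψ)
  ∨E   : ∀ {Γ Δ φ ψ χ} → Pf Ax Γ Δ (φ ∨' ψ) →
         Pf Ax Γ (φ ∷ Δ) χ → Pf Ax Γ (ψ ∷ Δ) χ → Pf Ax Γ Δ χ
  ⊃I   : ∀ {Γ Δ φ ψ} → Pf Ax Γ (φ ∷ Δ) ψ → Pf Ax Γ Δ (φ ⊃ ψ)
  ⊃E   : ∀ {Γ Δ φ ψ} → Pf Ax Γ Δ (φ ⊃ ψ) → Pf Ax Γ Δ φ → Pf Ax Γ Δ ψ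
  ∀I   : ∀ {Γ Δ σ φ} → Pf Ax (σ ∷ Γ) (map wkF Δ) φ → Pf Ax Γ Δ (all σ φ)
  ∀E   : ∀ {Γ Δ σ φ} → Pf Ax Γ Δ (all σ φ) → (t : Tm Γ σ) → Pf Ax Γ Δ (φ [ t ])
  ∃I   : ∀ {Γ Δ σ φ} (t : Tm Γ σ) → Pf Ax Γ Δ (φ [ t ]) → Pf Ax Γ Δ (ex σ φ)
  ∃E   : ∀ {Γ Δ σ φ ψ} → Pf Ax Γ Δ (ex σ φ) →
         Pf Ax (σ ∷ Γ) (φ ∷ map wkF Δ) (wkF ψ) → Pf Ax Γ Δ ψ

_⊢RH_ : (Γ : Ctx) → Fm Γ → Set
Γ ⊢RH φ = Pf AxRH Γ [] φ

module Submission where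

-- The map n ↦ embed σ n has the standard left inverse project σ, so it sends
-- nonstandard numbers to nonstandard objects.  Assuming ∀x (¬st x → φ x),
-- φ (embed σ n) therefore holds whenever n differs from every standard number.
-- HGMP weakens this hypothesis to "n avoids a certain standard finite list l";
-- as every entry of l is below k = Σ_{a ∈ l} (a + 1), each n gets a standard
-- threshold k with k ≤ n → φ (embed σ n).  R collects the thresholds of all n
-- into one standard list L, and n = Σ_{k ∈ L} (k + 1) lies above one of them,
-- so φ holds at the standard object embed σ n.

open import Defs
open import Data.List using (List; []; _∷_; map)
open import Data.List.Relation.Unary.Any using (here; there)
open import Data.Unit using (tt)
open import Data.Product using (_,_)
open import Relation.Binary.PropositionalEquality using (_≡_; refl; sym; trans; cong; cong₂)

-- Substitution

infix 4 _≗ᴿ_ _≗ˢ_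

_≗ᴿ_ : ∀ {Γ Δ} → Ren Γ Δ → Ren Γ Δ → Set
_≗ᴿ_ {Γ} r r' = ∀ {σ} (x : Var Γ σ) → r x ≡ r' x

_≗ˢ_ : ∀ {Γ Δ} → Sub Γ Δ → Sub Γ Δ → Set
_≗ˢ_ {Γ} s s' = ∀ {σ} (x : Var Γ σ) → s x ≡ s' x

liftR-cong : ∀ {Γ Δ τ} {r r' : Ren Γ Δ} → r ≗ᴿ r' → liftR {τ = τ} r ≗ᴿ liftR r'
liftR-cong eq vz     = refl
liftR-cong eq (vs x) = cong vs (eq x)

ren-cong : ∀ {Γ Δ σ} {r r' : Ren Γ Δ} → r ≗ᴿ r' → (t : Tm Γ σ) → ren r t ≡ ren r' t
ren-cong eq (var x)    = cong var (eq x)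
ren-cong eq (lam t)    = cong lam (ren-cong (liftR-cong eq) t)
ren-cong eq (app t u)  = cong₂ app (ren-cong eq t) (ren-cong eq u)
ren-cong eq zer        = refl
ren-cong eq suc        = refl
ren-cong eq (rec σ)    = refl
ren-cong eq (nil σ)    = refl
ren-cong eq (cons σ)   = refl
ren-cong eq (lrec σ τ) = refl

liftS-cong : ∀ {Γ Δ τ} {s s' : Sub Γ Δ} → s ≗ˢ s' → liftS {τ = τ} s ≗ˢ liftS s'
liftS-cong eq vz     = refl
liftS-cong eq (vs x) = cong (ren vs) (eq x)

sub-cong : ∀ {Γ Δ σ} {s s' : Sub Γ Δ} → s ≗ˢ s' → (t : Tm Γ σ) → sub s t ≡ sub s' t
sub-cong eq (var x)    = eq x
sub-cong eq (lam t)    = cong lam (sub-cong (liftS-cong eq) t)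
sub-cong eq (app t u)  = cong₂ app (sub-cong eq t) (sub-cong eq u)
sub-cong eq zer        = refl
sub-cong eq suc        = refl
sub-cong eq (rec σ)    = refl
sub-cong eq (nil σ)    = refl
sub-cong eq (cons σ)   = refl
sub-cong eq (lrec σ τ) = refl

ren-ren : ∀ {Γ Δ Θ σ} (r : Ren Δ Θ) (r' : Ren Γ Δ) (t : Tm Γ σ) →
          ren r (ren r' t) ≡ ren (λ x → r (r' x)) t
ren-ren r r' (var x)    = refl
ren-ren r r' (lam t)    = cong lam (trans (ren-ren (liftR r) (liftR r') t)
                                          (ren-cong (λ { vz → refl ; (vs x) → refl }) t))
ren-ren r r' (app t u)  = cong₂ app (ren-ren r r' t) (ren-ren r r' u)
ren-ren r r' zer        = refl
ren-ren r r' suc        = refl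
ren-ren r r' (rec σ)    = refl
ren-ren r r' (nil σ)    = refl
ren-ren r r' (cons σ)   = refl
ren-ren r r' (lrec σ τ) = refl

sub-ren : ∀ {Γ Δ Θ σ} (s : Sub Δ Θ) (r : Ren Γ Δ) (t : Tm Γ σ) →
          sub s (ren r t) ≡ sub (λ x → s (r x)) t
sub-ren s r (var x)    = refl
sub-ren s r (lam t)    = cong lam (trans (sub-ren (liftS s) (liftR r) t)
                                         (sub-cong (λ { vz → refl ; (vs x) → refl }) t))
sub-ren s r (app t u)  = cong₂ app (sub-ren s r t) (sub-ren s r u)
sub-ren s r zer        = refl
sub-ren s r suc        = refl
sub-ren s r (rec σ)    = refl
sub-ren s r (nil σ)    = refl
sub-ren s r (cons σ)   = refl
sub-ren s r (lrec σ τ) = refl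

ren-liftS : ∀ {Γ Δ Θ τ} (r : Ren Δ Θ) (s : Sub Γ Δ) →
            (λ {σ} x → ren (liftR {τ = τ} r) (liftS s {σ} x)) ≗ˢ liftS (λ x → ren r (s x))
ren-liftS r s vz     = refl
ren-liftS r s (vs x) = trans (ren-ren (liftR r) vs (s x)) (sym (ren-ren vs r (s x)))

ren-sub : ∀ {Γ Δ Θ σ} (r : Ren Δ Θ) (s : Sub Γ Δ) (t : Tm Γ σ) →
          ren r (sub s t) ≡ sub (λ x → ren r (s x)) t
ren-sub r s (var x)    = refl
ren-sub r s (lam t)    = cong lam (trans (ren-sub (liftR r) (liftS s) t) (sub-cong (ren-liftS r s) t))
ren-sub r s (app t u)  = cong₂ app (ren-sub r s t) (ren-sub r s u)
ren-sub r s zer        = refl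
ren-sub r s suc        = refl
ren-sub r s (rec σ)    = refl
ren-sub r s (nil σ)    = refl
ren-sub r s (cons σ)   = refl
ren-sub r s (lrec σ τ) = refl

sub-liftS : ∀ {Γ Δ Θ τ} (s : Sub Δ Θ) (s' : Sub Γ Δ) →
            (λ {σ} x → sub (liftS {τ = τ} s) (liftS s' {σ} x)) ≗ˢ liftS (λ x → sub s (s' x))
sub-liftS s s' vz     = refl
sub-liftS s s' (vs x) = trans (sub-ren (liftS s) vs (s' x)) (sym (ren-sub vs s (s' x)))

sub-sub : ∀ {Γ Δ Θ σ} (s : Sub Δ Θ) (s' : Sub Γ Δ) (t : Tm Γ σ) →
          sub s (sub s' t) ≡ sub (λ x → sub s (s' x)) t
sub-sub s s' (var x)    = refl
sub-sub s s' (lam t)    = cong lam (trans (sub-sub (liftS s) (liftS s') t) (sub-cong (sub-liftS s s') t))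
sub-sub s s' (app t u)  = cong₂ app (sub-sub s s' t) (sub-sub s s' u)
sub-sub s s' zer        = refl
sub-sub s s' suc        = refl
sub-sub s s' (rec σ)    = refl
sub-sub s s' (nil σ)    = refl
sub-sub s s' (cons σ)   = refl
sub-sub s s' (lrec σ τ) = refl

sub-var≡ren : ∀ {Γ Δ σ} (r : Ren Γ Δ) (t : Tm Γ σ) → sub (λ x → var (r x)) t ≡ ren r t
sub-var≡ren r (var x)    = refl
sub-var≡ren r (lam t)    = cong lam (trans (sub-cong (λ { vz → refl ; (vs x) → refl }) t)
                                            (sub-var≡ren (liftR r) t))
sub-var≡ren r (app t u)  = cong₂ app (sub-var≡ren r t) (sub-var≡ren r u)
sub-var≡ren r zer        = refl
sub-var≡ren r suc        = refl
sub-var≡ren r (rec σ)    = refl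
sub-var≡ren r (nil σ)    = refl
sub-var≡ren r (cons σ)   = refl
sub-var≡ren r (lrec σ τ) = refl

ren-id : ∀ {Γ σ} (t : Tm Γ σ) → ren (λ x → x) t ≡ t
ren-id (var x)    = refl
ren-id (lam t)    = cong lam (trans (ren-cong (λ { vz → refl ; (vs x) → refl }) t) (ren-id t))
ren-id (app t u)  = cong₂ app (ren-id t) (ren-id u)
ren-id zer        = refl
ren-id suc        = refl
ren-id (rec σ)    = refl
ren-id (nil σ)    = refl
ren-id (cons σ)   = refl
ren-id (lrec σ τ) = refl

sub-id : ∀ {Γ σ} (t : Tm Γ σ) → sub var t ≡ t
sub-id t = trans (sub-var≡ren (λ x → x) t) (ren-id t)

sub-ren≡ren : ∀ {Γ Δ Θ σ} (s : Sub Δ Θ) (r : Ren Γ Δ) (r' : Ren Γ Θ) →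
              (∀ {τ} (x : Var Γ τ) → s (r x) ≡ var (r' x)) →
              (u : Tm Γ σ) → sub s (ren r u) ≡ ren r' u
sub-ren≡ren s r r' eq u = trans (sub-ren s r u) (trans (sub-cong eq u) (sub-var≡ren r' u))

sub0-wk : ∀ {Γ σ τ} (t : Tm Γ τ) (u : Tm Γ σ) → wk u [ t ]ₜ ≡ u
sub0-wk t u = trans (sub-ren (sub0 t) vs u) (sub-id u)

sub-wk² : ∀ {Γ Δ σ α β} (s : Sub (α ∷ β ∷ Γ) Δ) (r : Ren Γ Δ) →
          (∀ {τ} (y : Var Γ τ) → s (vs (vs y)) ≡ var (r y)) →
          (a : Tm Γ σ) → sub s (wk (wk a)) ≡ ren r a
sub-wk² s r eq a = trans (cong (sub s) (ren-ren vs vs a)) (sub-ren≡ren s _ r eq a)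

sub0-liftS : ∀ {Γ Δ τ} (s : Sub Γ Δ) (b : Tm Δ τ) →
             (λ {σ} x → sub (sub0 b) (liftS s {σ} x)) ≗ˢ (s ▹ b)
sub0-liftS s b vz     = refl
sub0-liftS s b (vs x) = sub0-wk b (s x)

subF-cong : ∀ {Γ Δ} {s s' : Sub Γ Δ} → s ≗ˢ s' → (φ : Fm Γ) → subF s φ ≡ subF s' φ
subF-cong eq (a ≐ b)     = cong₂ _≐_ (sub-cong eq a) (sub-cong eq b)
subF-cong eq ⊥'          = refl
subF-cong eq (φ ∧' ψ)    = cong₂ _∧'_ (subF-cong eq φ) (subF-cong eq ψ)
subF-cong eq (φ ∨' ψ)    = cong₂ _∨'_ (subF-cong eq φ) (subF-cong eq ψ)
subF-cong eq (φ ⊃ ψ)     = cong₂ _⊃_ (subF-cong eq φ) (subF-cong eq ψ)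
subF-cong eq (all σ φ)   = cong (all σ) (subF-cong (liftS-cong eq) φ)
subF-cong eq (ex σ φ)    = cong (ex σ) (subF-cong (liftS-cong eq) φ)
subF-cong eq (st t)      = cong st (sub-cong eq t)
subF-cong eq (allSt σ φ) = cong (allSt σ) (subF-cong (liftS-cong eq) φ)
subF-cong eq (exSt σ φ)  = cong (exSt σ) (subF-cong (liftS-cong eq) φ)

subF-renF : ∀ {Γ Δ Θ} (s : Sub Δ Θ) (r : Ren Γ Δ) (φ : Fm Γ) →
            subF s (renF r φ) ≡ subF (λ x → s (r x)) φ
subF-renF-lift : ∀ {Γ Δ Θ τ} (s : Sub Δ Θ) (r : Ren Γ Δ) (φ : Fm (τ ∷ Γ)) →
                 subF (liftS s) (renF (liftR r) φ) ≡ subF (liftS (λ x → s (r x))) φ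

subF-renF s r (a ≐ b)     = cong₂ _≐_ (sub-ren s r a) (sub-ren s r b)
subF-renF s r ⊥'          = refl
subF-renF s r (φ ∧' ψ)    = cong₂ _∧'_ (subF-renF s r φ) (subF-renF s r ψ)
subF-renF s r (φ ∨' ψ)    = cong₂ _∨'_ (subF-renF s r φ) (subF-renF s r ψ)
subF-renF s r (φ ⊃ ψ)     = cong₂ _⊃_ (subF-renF s r φ) (subF-renF s r ψ)
subF-renF s r (all σ φ)   = cong (all σ) (subF-renF-lift s r φ)
subF-renF s r (ex σ φ)    = cong (ex σ) (subF-renF-lift s r φ)
subF-renF s r (st t)      = cong st (sub-ren s r t)
subF-renF s r (allSt σ φ) = cong (allSt σ) (subF-renF-lift s r φ)
subF-renF s r (exSt σ φ)  = cong (exSt σ) (subF-renF-lift s r φ)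

subF-renF-lift s r φ =
  trans (subF-renF (liftS s) (liftR r) φ) (subF-cong (λ { vz → refl ; (vs x) → refl }) φ)

renF-subF : ∀ {Γ Δ Θ} (r : Ren Δ Θ) (s : Sub Γ Δ) (φ : Fm Γ) →
            renF r (subF s φ) ≡ subF (λ x → ren r (s x)) φ
renF-subF-lift : ∀ {Γ Δ Θ τ} (r : Ren Δ Θ) (s : Sub Γ Δ) (φ : Fm (τ ∷ Γ)) →
                 renF (liftR r) (subF (liftS s) φ) ≡ subF (liftS (λ x → ren r (s x))) φ

renF-subF r s (a ≐ b)     = cong₂ _≐_ (ren-sub r s a) (ren-sub r s b)
renF-subF r s ⊥'          = refl
renF-subF r s (φ ∧' ψ)    = cong₂ _∧'_ (renF-subF r s φ) (renF-subF r s ψ)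
renF-subF r s (φ ∨' ψ)    = cong₂ _∨'_ (renF-subF r s φ) (renF-subF r s ψ)
renF-subF r s (φ ⊃ ψ)     = cong₂ _⊃_ (renF-subF r s φ) (renF-subF r s ψ)
renF-subF r s (all σ φ)   = cong (all σ) (renF-subF-lift r s φ)
renF-subF r s (ex σ φ)    = cong (ex σ) (renF-subF-lift r s φ)
renF-subF r s (st t)      = cong st (ren-sub r s t)
renF-subF r s (allSt σ φ) = cong (allSt σ) (renF-subF-lift r s φ)
renF-subF r s (exSt σ φ)  = cong (exSt σ) (renF-subF-lift r s φ)

renF-subF-lift r s φ = trans (renF-subF (liftR r) (liftS s) φ) (subF-cong (ren-liftS r s) φ)

subF-subF : ∀ {Γ Δ Θ} (s : Sub Δ Θ) (s' : Sub Γ Δ) (φ : Fm Γ) →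
            subF s (subF s' φ) ≡ subF (λ x → sub s (s' x)) φ
subF-subF-lift : ∀ {Γ Δ Θ τ} (s : Sub Δ Θ) (s' : Sub Γ Δ) (φ : Fm (τ ∷ Γ)) →
                 subF (liftS s) (subF (liftS s') φ) ≡ subF (liftS (λ x → sub s (s' x))) φ

subF-subF s s' (a ≐ b)     = cong₂ _≐_ (sub-sub s s' a) (sub-sub s s' b)
subF-subF s s' ⊥'          = refl
subF-subF s s' (φ ∧' ψ)    = cong₂ _∧'_ (subF-subF s s' φ) (subF-subF s s' ψ)
subF-subF s s' (φ ∨' ψ)    = cong₂ _∨'_ (subF-subF s s' φ) (subF-subF s s' ψ)
subF-subF s s' (φ ⊃ ψ)     = cong₂ _⊃_ (subF-subF s s' φ) (subF-subF s s' ψ)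
subF-subF s s' (all σ φ)   = cong (all σ) (subF-subF-lift s s' φ)
subF-subF s s' (ex σ φ)    = cong (ex σ) (subF-subF-lift s s' φ)
subF-subF s s' (st t)      = cong st (sub-sub s s' t)
subF-subF s s' (allSt σ φ) = cong (allSt σ) (subF-subF-lift s s' φ)
subF-subF s s' (exSt σ φ)  = cong (exSt σ) (subF-subF-lift s s' φ)

subF-subF-lift s s' φ = trans (subF-subF (liftS s) (liftS s') φ) (subF-cong (sub-liftS s s') φ)

subF-sub0-liftS : ∀ {Γ Δ τ} (s : Sub Γ Δ) (b : Tm Δ τ) (φ : Fm (τ ∷ Γ)) →
                  subF (liftS s) φ [ b ] ≡ subF (s ▹ b) φ
subF-sub0-liftS s b φ = trans (subF-subF (sub0 b) (liftS s) φ) (subF-cong (sub0-liftS s b) φ)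

subF-internal : ∀ {Γ Δ} (s : Sub Γ Δ) (φ : Fm Γ) → Internal φ → Internal (subF s φ)
subF-internal s (a ≐ b)   i       = tt
subF-internal s ⊥'        i       = tt
subF-internal s (φ ∧' ψ)  (i , j) = subF-internal s φ i , subF-internal s ψ j
subF-internal s (φ ∨' ψ)  (i , j) = subF-internal s φ i , subF-internal s ψ j
subF-internal s (φ ⊃ ψ)   (i , j) = subF-internal s φ i , subF-internal s ψ j
subF-internal s (all σ φ) i       = subF-internal (liftS s) φ i
subF-internal s (ex σ φ)  i       = subF-internal (liftS s) φ i

v0 : ∀ {Γ σ} → Tm (σ ∷ Γ) σ
v0 = var vz

v1 : ∀ {Γ σ τ} → Tm (τ ∷ σ ∷ Γ) σ
v1 = var (vs vz)

v2 : ∀ {Γ σ τ ρ} → Tm (ρ ∷ τ ∷ σ ∷ Γ) σ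
v2 = var (vs (vs vz))

S : ∀ {Γ} → Tm Γ 𝕆 → Tm Γ 𝕆
S t = app suc t

infixr 7 _∷ₜ_

_∷ₜ_ : ∀ {Γ σ} → Tm Γ σ → Tm Γ (Seq σ) → Tm Γ (Seq σ)
_∷ₜ_ {σ = σ} a l = app (app (cons σ) a) l

plus-step : ∀ {Γ} → Tm Γ (𝕆 ⇒ 𝕆 ⇒ 𝕆)
plus-step = lam (lam (S v1))

len-step : ∀ {Γ σ} → Tm Γ (σ ⇒ Seq σ ⇒ 𝕆 ⇒ 𝕆)
len-step = lam (lam (lam (S v0)))

nth-step : ∀ {Γ σ} → Tm Γ (σ ⇒ Seq σ ⇒ (𝕆 ⇒ σ) ⇒ 𝕆 ⇒ σ)
nth-step {σ = σ} = lam (lam (lam (lam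
  (app (app (app (rec σ) (var (vs (vs (vs vz))))) (lam (lam (app (var (vs (vs (vs vz)))) v0)))) v0))))

nthT : ∀ {Γ σ} → Tm Γ (Seq σ ⇒ 𝕆 ⇒ σ)
nthT {σ = σ} = app (app (lrec σ (𝕆 ⇒ σ)) (lam (zeroOf σ))) nth-step

sumSuc-step : ∀ {Γ} → Tm Γ (𝕆 ⇒ Seq 𝕆 ⇒ 𝕆 ⇒ 𝕆)
sumSuc-step = lam (lam (lam (plus v2 (S v0))))

sumSucT : ∀ {Γ} → Tm Γ (Seq 𝕆 ⇒ 𝕆)
sumSucT = app (app (lrec 𝕆 𝕆) zer) sumSuc-step

sumSuc : ∀ {Γ} → Tm Γ (Seq 𝕆) → Tm Γ 𝕆
sumSuc l = app sumSucT l

embed : ∀ {Γ} σ → Tm Γ (𝕆 ⇒ σ)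
embed 𝕆       = lam v0
embed (σ ⇒ τ) = lam (lam (app (embed τ) v1))
embed (Seq σ) = lam (app (embed σ) v0 ∷ₜ nil σ)

project : ∀ {Γ} σ → Tm Γ (σ ⇒ 𝕆)
project 𝕆       = lam v0
project (σ ⇒ τ) = lam (app (project τ) (app v0 (zeroOf σ)))
project (Seq σ) = lam (app (app (app (lrec σ 𝕆) zer) (lam (lam (lam (app (project σ) v2))))) v0)

sub-zeroOf : ∀ {Γ Δ} σ (s : Sub Γ Δ) → sub s (zeroOf σ) ≡ zeroOf σ
sub-zeroOf 𝕆       s = refl
sub-zeroOf (σ ⇒ τ) s = cong lam (sub-zeroOf τ (liftS s))
sub-zeroOf (Seq σ) s = refl

sub-embed : ∀ {Γ Δ} σ (s : Sub Γ Δ) → sub s (embed σ) ≡ embed σ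
sub-embed 𝕆       s = refl
sub-embed (σ ⇒ τ) s = cong (λ z → lam (lam (app z v1))) (sub-embed τ _)
sub-embed (Seq σ) s = cong (λ z → lam (app z v0 ∷ₜ nil σ)) (sub-embed σ _)

sub-project : ∀ {Γ Δ} σ (s : Sub Γ Δ) → sub s (project σ) ≡ project σ
sub-project 𝕆       s = refl
sub-project (σ ⇒ τ) s = cong₂ (λ z u → lam (app z (app v0 u))) (sub-project τ _) (sub-zeroOf σ _)
sub-project (Seq σ) s =
  cong (λ z → lam (app (app (app (lrec σ 𝕆) zer) (lam (lam (lam (app z v2))))) v0)) (sub-project σ _)

ren-embed : ∀ {Γ Δ} σ (r : Ren Γ Δ) → ren r (embed σ) ≡ embed σ
ren-embed σ r = trans (sym (sub-var≡ren r (embed σ))) (sub-embed σ _)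

ren-project : ∀ {Γ Δ} σ (r : Ren Γ Δ) → ren r (project σ) ≡ project σ
ren-project σ r = trans (sym (sub-var≡ren r (project σ))) (sub-project σ _)

module Derivations {Ax : ∀ {Γ} → Fm Γ → Set} (baseAx : ∀ {Γ} {φ : Fm Γ} → BaseAx φ → Ax φ) where

  infix 2 _∣_⊢_

  _∣_⊢_ : (Γ : Ctx) → List (Fm Γ) → Fm Γ → Set
  _∣_⊢_ = Pf Ax

  axiom : ∀ {Γ Δ} {φ : Fm Γ} → BaseAx φ → Γ ∣ Δ ⊢ φ
  axiom a = ax (baseAx a)

  hyp₀ : ∀ {Γ Δ} {a : Fm Γ} → Γ ∣ a ∷ Δ ⊢ a
  hyp₀ = hyp (here refl)

  hyp₁ : ∀ {Γ Δ} {a b : Fm Γ} → Γ ∣ b ∷ a ∷ Δ ⊢ a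
  hyp₁ = hyp (there (here refl))

  hyp₂ : ∀ {Γ Δ} {a b c : Fm Γ} → Γ ∣ c ∷ b ∷ a ∷ Δ ⊢ a
  hyp₂ = hyp (there (there (here refl)))

  hyp₅ : ∀ {Γ Δ} {a b c d e f : Fm Γ} → Γ ∣ f ∷ e ∷ d ∷ c ∷ b ∷ a ∷ Δ ⊢ a
  hyp₅ = hyp (there (there (there (there (there (here refl))))))

  hyp₆ : ∀ {Γ Δ} {a b c d e f g : Fm Γ} → Γ ∣ g ∷ f ∷ e ∷ d ∷ c ∷ b ∷ a ∷ Δ ⊢ a
  hyp₆ = hyp (there (there (there (there (there (there (here refl)))))))

  hyp₇ : ∀ {Γ Δ} {a b c d e f g h : Fm Γ} → Γ ∣ h ∷ g ∷ f ∷ e ∷ d ∷ c ∷ b ∷ a ∷ Δ ⊢ a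
  hyp₇ = hyp (there (there (there (there (there (there (there (here refl))))))))

  cast : ∀ {Γ Δ} {φ ψ : Fm Γ} → φ ≡ ψ → Γ ∣ Δ ⊢ φ → Γ ∣ Δ ⊢ ψ
  cast refl p = p

  cast≐ : ∀ {Γ Δ σ} {a b a' b' : Tm Γ σ} → a ≡ a' → b ≡ b' → Γ ∣ Δ ⊢ a ≐ b → Γ ∣ Δ ⊢ a' ≐ b'
  cast≐ refl refl p = p

  ∀E₂ : ∀ {Γ Δ σ τ} {φ : Fm (τ ∷ σ ∷ Γ)} → Γ ∣ Δ ⊢ all σ (all τ φ) →
        (a : Tm Γ σ) (b : Tm Γ τ) → Γ ∣ Δ ⊢ subF ((var ▹ a) ▹ b) φ
  ∀E₂ {φ = φ} p a b = cast (subF-sub0-liftS (sub0 a) b φ) (∀E (∀E p a) b)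

  ∀E₃ : ∀ {Γ Δ σ τ ρ} {φ : Fm (ρ ∷ τ ∷ σ ∷ Γ)} → Γ ∣ Δ ⊢ all σ (all τ (all ρ φ)) →
        (a : Tm Γ σ) (b : Tm Γ τ) (c : Tm Γ ρ) → Γ ∣ Δ ⊢ subF (((var ▹ a) ▹ b) ▹ c) φ
  ∀E₃ {φ = φ} p a b c =
    cast (trans (cong (subF (sub0 c)) subF-sub1-liftS²) (subF-sub0-liftS ((var ▹ a) ▹ b) c φ))
         (∀E (∀E (∀E p a) b) c)
    where
    subF-sub1-liftS² : subF (liftS (sub0 b)) (subF (liftS (liftS (sub0 a))) φ)
                       ≡ subF (liftS ((var ▹ a) ▹ b)) φ
    subF-sub1-liftS² =
      trans (subF-subF (liftS (sub0 b)) (liftS (liftS (sub0 a))) φ)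
            (subF-cong (λ x → trans (sub-liftS (sub0 b) (liftS (sub0 a)) x)
                                    (liftS-cong (sub0-liftS (sub0 a) b) x)) φ)

  induction : ∀ {Γ Δ} (φ : Fm (𝕆 ∷ Γ)) → Internal φ → Γ ∣ Δ ⊢ φ [ zer ] →
              𝕆 ∷ Γ ∣ φ ∷ map wkF Δ ⊢ succF φ → Γ ∣ Δ ⊢ all 𝕆 φ
  induction φ i zeroCase sucCase = ⊃E (⊃E (axiom (ind φ i)) zeroCase) (∀I (⊃I sucCase))

  ≐-subst : ∀ {Γ Δ σ} (φ : Fm (σ ∷ Γ)) → Internal φ → {s t : Tm Γ σ} →
            Γ ∣ Δ ⊢ s ≐ t → Γ ∣ Δ ⊢ φ [ s ] → Γ ∣ Δ ⊢ φ [ t ]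
  ≐-subst φ i {s} {t} p q = ⊃E (⊃E (axiom (eqSubst φ i s t)) p) q

  ≐-refl : ∀ {Γ Δ σ} {t : Tm Γ σ} → Γ ∣ Δ ⊢ t ≐ t
  ≐-refl {t = t} = axiom (eqRefl t)

  ≐-sym : ∀ {Γ Δ σ} {s t : Tm Γ σ} → Γ ∣ Δ ⊢ s ≐ t → Γ ∣ Δ ⊢ t ≐ s
  ≐-sym {s = s} {t} p =
    cast≐ refl (sub0-wk t s) (≐-subst (v0 ≐ wk s) tt p (cast≐ refl (sym (sub0-wk s s)) ≐-refl))

  ≐-trans : ∀ {Γ Δ σ} {s t u : Tm Γ σ} → Γ ∣ Δ ⊢ s ≐ t → Γ ∣ Δ ⊢ t ≐ u → Γ ∣ Δ ⊢ s ≐ u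
  ≐-trans {s = s} {t} {u} p q =
    cast≐ (sub0-wk u s) refl (≐-subst (wk s ≐ v0) tt q (cast≐ (sym (sub0-wk t s)) refl p))

  ≐-cong : ∀ {Γ Δ τ ρ} (C : Tm (τ ∷ Γ) ρ) {s t : Tm Γ τ} →
           Γ ∣ Δ ⊢ s ≐ t → Γ ∣ Δ ⊢ C [ s ]ₜ ≐ C [ t ]ₜ
  ≐-cong C {s} {t} p =
    cast≐ (sub0-wk t (C [ s ]ₜ)) refl
      (≐-subst (wk (C [ s ]ₜ) ≐ C) tt p (cast≐ (sym (sub0-wk s (C [ s ]ₜ))) refl ≐-refl))

  app-congˡ : ∀ {Γ Δ σ τ} {f g : Tm Γ (σ ⇒ τ)} (u : Tm Γ σ) →
              Γ ∣ Δ ⊢ f ≐ g → Γ ∣ Δ ⊢ app f u ≐ app g u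
  app-congˡ {f = f} {g} u p =
    cast≐ (cong (app f) (sub0-wk f u)) (cong (app g) (sub0-wk g u)) (≐-cong (app v0 (wk u)) p)

  app-congʳ : ∀ {Γ Δ σ τ} (f : Tm Γ (σ ⇒ τ)) {s t : Tm Γ σ} →
              Γ ∣ Δ ⊢ s ≐ t → Γ ∣ Δ ⊢ app f s ≐ app f t
  app-congʳ f {s} {t} p =
    cast≐ (cong (λ z → app z s) (sub0-wk s f)) (cong (λ z → app z t) (sub0-wk t f))
      (≐-cong (app (wk f) v0) p)

  β : ∀ {Γ Δ σ τ} (b : Tm (σ ∷ Γ) τ) (t : Tm Γ σ) → Γ ∣ Δ ⊢ app (lam b) t ≐ b [ t ]ₜ
  β b t = axiom (beta b t)

  suc≢zero : ∀ {Γ Δ} {t : Tm Γ 𝕆} → Γ ∣ Δ ⊢ S t ≐ zer → Γ ∣ Δ ⊢ ⊥'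
  suc≢zero {t = t} p = ⊃E (axiom (sucNZ t)) p

  suc-injective : ∀ {Γ Δ} {s t : Tm Γ 𝕆} → Γ ∣ Δ ⊢ S s ≐ S t → Γ ∣ Δ ⊢ s ≐ t
  suc-injective {s = s} {t} p = ⊃E (axiom (sucInj s t)) p

  zero-or-suc : ∀ {Γ Δ} → Γ ∣ Δ ⊢ all 𝕆 (v0 ≐ zer ∨' ex 𝕆 (v1 ≐ S v0))
  zero-or-suc = induction _ (tt , tt) (∨I₁ ≐-refl) (∨I₂ (∃I v0 ≐-refl))

  -- Arithmetic

  plus-identityʳ : ∀ {Γ Δ} (x : Tm Γ 𝕆) → Γ ∣ Δ ⊢ plus x zer ≐ x
  plus-identityʳ x = axiom (recZ x plus-step)

  plus-suc : ∀ {Γ Δ} (x n : Tm Γ 𝕆) → Γ ∣ Δ ⊢ plus x (S n) ≐ S (plus x n)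
  plus-suc x n =
    ≐-trans (axiom (recS x plus-step n))
    (≐-trans (app-congˡ n (β (lam (S v1)) (plus x n)))
             (cast≐ refl (cong S (sub0-wk n (plus x n))) (β _ n)))

  plus-congˡ : ∀ {Γ Δ} {x y : Tm Γ 𝕆} (z : Tm Γ 𝕆) → Γ ∣ Δ ⊢ x ≐ y → Γ ∣ Δ ⊢ plus x z ≐ plus y z
  plus-congˡ z p = app-congˡ z (app-congˡ plus-step (app-congʳ (rec 𝕆) p))

  plus-congʳ : ∀ {Γ Δ} (x : Tm Γ 𝕆) {y z : Tm Γ 𝕆} → Γ ∣ Δ ⊢ y ≐ z → Γ ∣ Δ ⊢ plus x y ≐ plus x z
  plus-congʳ x = app-congʳ (app (app (rec 𝕆) x) plus-step)

  plus-identityˡ : ∀ {Γ Δ} (y : Tm Γ 𝕆) → Γ ∣ Δ ⊢ plus zer y ≐ y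
  plus-identityˡ y = ∀E identityˡ y
    where
    identityˡ : ∀ {Γ Δ} → Γ ∣ Δ ⊢ all 𝕆 (plus zer v0 ≐ v0)
    identityˡ = induction _ tt (plus-identityʳ zer) (≐-trans (plus-suc zer v0) (app-congʳ suc hyp₀))

  plus-sucˡ : ∀ {Γ Δ} (x y : Tm Γ 𝕆) → Γ ∣ Δ ⊢ plus (S x) y ≐ S (plus x y)
  plus-sucˡ x y = ∀E₂ sucˡ x y
    where
    sucˡ : ∀ {Γ Δ} → Γ ∣ Δ ⊢ all 𝕆 (all 𝕆 (plus (S v1) v0 ≐ S (plus v1 v0)))
    sucˡ = ∀I (induction _ tt
      (≐-trans (plus-identityʳ _) (app-congʳ suc (≐-sym (plus-identityʳ _))))
      (≐-trans (plus-suc _ _) (≐-trans (app-congʳ suc hyp₀) (app-congʳ suc (≐-sym (plus-suc _ _))))))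

  plus-comm : ∀ {Γ Δ} (x y : Tm Γ 𝕆) → Γ ∣ Δ ⊢ plus x y ≐ plus y x
  plus-comm x y = ∀E₂ comm x y
    where
    comm : ∀ {Γ Δ} → Γ ∣ Δ ⊢ all 𝕆 (all 𝕆 (plus v1 v0 ≐ plus v0 v1))
    comm = ∀I (induction _ tt
      (≐-trans (plus-identityʳ _) (≐-sym (plus-identityˡ _)))
      (≐-trans (plus-suc _ _) (≐-trans (app-congʳ suc hyp₀) (≐-sym (plus-sucˡ _ _)))))

  plus-assoc : ∀ {Γ Δ} (x y z : Tm Γ 𝕆) → Γ ∣ Δ ⊢ plus (plus x y) z ≐ plus x (plus y z)
  plus-assoc x y z = ∀E₃ assoc x y z
    where
    assoc : ∀ {Γ Δ} → Γ ∣ Δ ⊢ all 𝕆 (all 𝕆 (all 𝕆 (plus (plus v2 v1) v0 ≐ plus v2 (plus v1 v0))))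
    assoc = ∀I (∀I (induction _ tt
      (≐-trans (plus-identityʳ _) (plus-congʳ _ (≐-sym (plus-identityʳ _))))
      (≐-trans (plus-suc _ _)
      (≐-trans (app-congʳ suc hyp₀)
      (≐-trans (≐-sym (plus-suc _ _)) (plus-congʳ _ (≐-sym (plus-suc _ _))))))))

  plus-suc≢ : ∀ {Γ Δ} (x u : Tm Γ 𝕆) → Γ ∣ Δ ⊢ plus x (S u) ≐ x → Γ ∣ Δ ⊢ ⊥'
  plus-suc≢ x u = ⊃E (∀E₂ irreflexive x u)
    where
    irreflexive : ∀ {Γ Δ} → Γ ∣ Δ ⊢ all 𝕆 (all 𝕆 (¬' (plus v1 (S v0) ≐ v1)))
    irreflexive = induction _ (tt , tt)
      (∀I (⊃I (suc≢zero (≐-trans (≐-sym (plus-suc zer v0)) hyp₀))))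
      (∀I (⊃I (⊃E (∀E hyp₁ v0)
        (suc-injective
          (≐-trans (app-congʳ suc (plus-suc _ _))
          (≐-trans (app-congʳ suc (≐-sym (plus-sucˡ _ _)))
          (≐-trans (≐-sym (plus-suc _ _)) hyp₀)))))))

  lt-intro : ∀ {Γ Δ} {s t : Tm Γ 𝕆} (k : Tm Γ 𝕆) → Γ ∣ Δ ⊢ plus s (S k) ≐ t → Γ ∣ Δ ⊢ lt s t
  lt-intro {s = s} {t} k p =
    ∃I k (cast≐ (cong (λ z → plus z (S k)) (sym (sub0-wk k s))) (sym (sub0-wk k t)) p)

  lt-trans : ∀ {Γ Δ} {a b c : Tm Γ 𝕆} → Γ ∣ Δ ⊢ lt a b → Γ ∣ Δ ⊢ lt b c → Γ ∣ Δ ⊢ lt a c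
  lt-trans {a = a} {b} {c} p q = ⊃E (⊃E (∀E₃ transitive a b c) p) q
    where
    transitive : ∀ {Γ Δ} → Γ ∣ Δ ⊢ all 𝕆 (all 𝕆 (all 𝕆 (lt v2 v1 ⊃ lt v1 v0 ⊃ lt v2 v0)))
    transitive = ∀I (∀I (∀I (⊃I (⊃I (∃E hyp₁ (∃E hyp₁ (∃I (plus (S v1) v0)
      (≐-trans (plus-congʳ _ (≐-sym (plus-suc _ _)))
      (≐-trans (≐-sym (plus-assoc _ _ _))
      (≐-trans (plus-congˡ _ hyp₁) hyp₀))))))))))

  lt-pred : ∀ {Γ Δ} {j m : Tm Γ 𝕆} → Γ ∣ Δ ⊢ lt (S j) (S m) → Γ ∣ Δ ⊢ lt j m
  lt-pred {j = j} {m} = ⊃E (∀E₂ pred j m)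
    where
    pred : ∀ {Γ Δ} → Γ ∣ Δ ⊢ all 𝕆 (all 𝕆 (lt (S v1) (S v0) ⊃ lt v1 v0))
    pred = ∀I (∀I (⊃I (∃E hyp₀ (lt-intro v0 (suc-injective (≐-trans (≐-sym (plus-sucˡ _ _)) hyp₀))))))

  lt-congˡ : ∀ {Γ Δ} {s s' t : Tm Γ 𝕆} → Γ ∣ Δ ⊢ s ≐ s' → Γ ∣ Δ ⊢ lt s t → Γ ∣ Δ ⊢ lt s' t
  lt-congˡ {s = s} {s'} {t} e p =
    cast (cong (λ z → ex 𝕆 (plus (wk s') (S v0) ≐ z)) (sub-wk² (liftS (sub0 s')) vs (λ y → refl) t))
      (≐-subst (lt v0 (wk t)) tt e
        (cast (cong (λ z → ex 𝕆 (plus (wk s) (S v0) ≐ z)) (sym (sub-wk² (liftS (sub0 s)) vs (λ y → refl) t)))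
              p))

  lt-congʳ : ∀ {Γ Δ} {s t t' : Tm Γ 𝕆} → Γ ∣ Δ ⊢ t ≐ t' → Γ ∣ Δ ⊢ lt s t → Γ ∣ Δ ⊢ lt s t'
  lt-congʳ {s = s} {t} {t'} e p =
    cast (cong (λ z → ex 𝕆 (plus z (S v0) ≐ wk t')) (sub-wk² (liftS (sub0 t')) vs (λ y → refl) s))
      (≐-subst (lt (wk s) v0) tt e
        (cast (cong (λ z → ex 𝕆 (plus z (S v0) ≐ wk t)) (sym (sub-wk² (liftS (sub0 t)) vs (λ y → refl) s)))
              p))

  lt-cong : ∀ {Γ Δ} {s s' t t' : Tm Γ 𝕆} → Γ ∣ Δ ⊢ s ≐ s' → Γ ∣ Δ ⊢ t ≐ t' →
            Γ ∣ Δ ⊢ lt s t → Γ ∣ Δ ⊢ lt s' t'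
  lt-cong e e' p = lt-congʳ e' (lt-congˡ e p)

  ≮zero : ∀ {Γ Δ} {s : Tm Γ 𝕆} → Γ ∣ Δ ⊢ lt s zer → Γ ∣ Δ ⊢ ⊥'
  ≮zero p = ∃E p (suc≢zero (≐-trans (≐-sym (plus-suc _ _)) hyp₀))

  lt-plus-suc : ∀ {Γ Δ} (a t : Tm Γ 𝕆) → Γ ∣ Δ ⊢ lt t (plus a (S t))
  lt-plus-suc a t =
    lt-intro a (≐-trans (plus-suc _ _) (≐-trans (app-congʳ suc (plus-comm _ _)) (≐-sym (plus-suc _ _))))

  lt⇒≢plus : ∀ {Γ Δ} {a b c : Tm Γ 𝕆} → Γ ∣ Δ ⊢ lt a b → Γ ∣ Δ ⊢ a ≐ plus b c → Γ ∣ Δ ⊢ ⊥'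
  lt⇒≢plus {a = a} {b} {c} p e = ⊃E (∃E p (⊃I (plus-suc≢ _ (plus v0 (wk c))
    (≐-trans (plus-congʳ _ (≐-sym (plus-sucˡ _ _)))
    (≐-trans (≐-sym (plus-assoc _ _ _))
    (≐-trans (plus-congˡ _ hyp₁) (≐-sym hyp₀))))))) e

  -- Sequences

  len-cong : ∀ {Γ Δ σ} {l l' : Tm Γ (Seq σ)} → Γ ∣ Δ ⊢ l ≐ l' → Γ ∣ Δ ⊢ len l ≐ len l'
  len-cong {σ = σ} = app-congʳ (app (app (lrec σ 𝕆) zer) len-step)

  len-nil : ∀ {Γ Δ σ} → Γ ∣ Δ ⊢ len (nil σ) ≐ zer
  len-nil = axiom (lrecNil zer len-step)

  len-cons : ∀ {Γ Δ σ} (a : Tm Γ σ) (l : Tm Γ (Seq σ)) → Γ ∣ Δ ⊢ len (a ∷ₜ l) ≐ S (len l)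
  len-cons a l =
    ≐-trans (axiom (lrecCons zer len-step a l))
    (≐-trans (app-congˡ _ (app-congˡ l (β _ a)))
    (≐-trans (app-congˡ _ (β _ l)) (β _ _)))

  len-tail : ∀ {Γ Δ σ} {l : Tm Γ (Seq σ)} {n : Tm Γ 𝕆} (a : Tm Γ σ) (l' : Tm Γ (Seq σ)) →
             Γ ∣ Δ ⊢ l ≐ a ∷ₜ l' → Γ ∣ Δ ⊢ len l ≐ S n → Γ ∣ Δ ⊢ len l' ≐ n
  len-tail a l' l≐ p = suc-injective (≐-trans (≐-sym (len-cons a l')) (≐-trans (≐-sym (len-cong l≐)) p))

  lt-len-tail : ∀ {Γ Δ σ} {l : Tm Γ (Seq σ)} {i j : Tm Γ 𝕆} (a : Tm Γ σ) (l' : Tm Γ (Seq σ)) →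
                Γ ∣ Δ ⊢ l ≐ a ∷ₜ l' → Γ ∣ Δ ⊢ i ≐ S j → Γ ∣ Δ ⊢ lt i (len l) → Γ ∣ Δ ⊢ lt j (len l')
  lt-len-tail a l' l≐ i≐ p = lt-pred (lt-cong i≐ (≐-trans (len-cong l≐) (len-cons a l')) p)

  nth-cong : ∀ {Γ Δ σ} {l l' : Tm Γ (Seq σ)} {i i' : Tm Γ 𝕆} →
             Γ ∣ Δ ⊢ l ≐ l' → Γ ∣ Δ ⊢ i ≐ i' → Γ ∣ Δ ⊢ nth l i ≐ nth l' i'
  nth-cong {l' = l'} {i} p q = ≐-trans (app-congˡ i (app-congʳ nthT p)) (app-congʳ (app nthT l') q)

  nth-cons : ∀ {Γ Δ σ} (a : Tm Γ σ) (l : Tm Γ (Seq σ)) (i : Tm Γ 𝕆) →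
             Γ ∣ Δ ⊢ nth (a ∷ₜ l) i ≐ app (app (app (rec σ) a) (lam (lam (app (wk (wk (app nthT l))) v0)))) i
  nth-cons a l i =
    ≐-trans (app-congˡ i (axiom (lrecCons (lam (zeroOf _)) nth-step a l)))
    (≐-trans (app-congˡ i (app-congˡ _ (app-congˡ l (β _ a))))
    (≐-trans (app-congˡ i (app-congˡ _ (β _ l)))
    (≐-trans (app-congˡ i (β _ _))
    (cast≐ refl (cong₂ (λ u v → app (app (app (rec _) u) (lam (lam (app v v0)))) i) head-eq tail-eq)
      (β _ i)))))
    where
    wk³ : ∀ {Γ σ α β γ} (t : Tm Γ σ) →
          ren (vs {τ = α}) (ren (vs {τ = β}) (ren (vs {τ = γ}) t)) ≡ ren (λ y → vs (vs (vs y))) t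
    wk³ t = trans (cong (ren vs) (ren-ren vs vs t)) (ren-ren vs _ t)
    head-eq : sub (sub0 i) (sub (liftS (sub0 (app nthT l))) (sub (liftS (liftS (sub0 l))) (wk (wk (wk a)))))
              ≡ a
    head-eq = trans (cong (sub (sub0 i))
                      (trans (cong (sub (liftS (sub0 (app nthT l))))
                               (trans (cong (sub _) (wk³ a)) (sub-ren≡ren _ _ (λ y → vs (vs y)) (λ y → refl) a)))
                             (sub-ren≡ren _ _ vs (λ y → refl) a)))
                    (sub0-wk i a)
    tail-eq : sub (liftS (liftS (sub0 i))) (wk (wk (wk (app nthT l)))) ≡ wk (wk (app nthT l))
    tail-eq = trans (cong (sub _) (wk³ (app nthT l)))
                (trans (sub-ren≡ren _ _ (λ y → vs (vs y)) (λ y → refl) (app nthT l))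
                       (sym (ren-ren vs vs (app nthT l))))

  nth-cons-zero : ∀ {Γ Δ σ} (a : Tm Γ σ) (l : Tm Γ (Seq σ)) → Γ ∣ Δ ⊢ nth (a ∷ₜ l) zer ≐ a
  nth-cons-zero a l = ≐-trans (nth-cons a l zer) (axiom (recZ a _))

  nth-cons-suc : ∀ {Γ Δ σ} (a : Tm Γ σ) (l : Tm Γ (Seq σ)) (j : Tm Γ 𝕆) →
                 Γ ∣ Δ ⊢ nth (a ∷ₜ l) (S j) ≐ nth l j
  nth-cons-suc a l j =
    ≐-trans (nth-cons a l (S j))
    (≐-trans (axiom (recS a _ j))
    (≐-trans (app-congˡ j (β _ _))
    (cast≐ refl (cong (λ u → app u j) (trans (cong (sub (sub0 j)) (sub-wk² _ vs (λ y → refl) (app nthT l)))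
                                             (sub0-wk j (app nthT l))))
      (β _ j))))

  sumSuc-cons : ∀ {Γ Δ} (a : Tm Γ 𝕆) (l : Tm Γ (Seq 𝕆)) →
                Γ ∣ Δ ⊢ sumSuc (a ∷ₜ l) ≐ plus a (S (sumSuc l))
  sumSuc-cons a l =
    ≐-trans (axiom (lrecCons zer sumSuc-step a l))
    (≐-trans (app-congˡ _ (app-congˡ l (β _ a)))
    (≐-trans (app-congˡ _ (β _ l))
    (cast≐ refl (cong (λ z → plus z (S (sumSuc l)))
                  (trans (cong (sub (sub0 (sumSuc l))) (sub-wk² (liftS (sub0 l)) vs (λ y → refl) a))
                         (sub0-wk (sumSuc l) a)))
      (β _ _))))

  nth<sumSuc-head : ∀ {Γ Δ} {l : Tm Γ (Seq 𝕆)} {i : Tm Γ 𝕆} (a : Tm Γ 𝕆) (l' : Tm Γ (Seq 𝕆)) →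
                    Γ ∣ Δ ⊢ l ≐ a ∷ₜ l' → Γ ∣ Δ ⊢ i ≐ zer → Γ ∣ Δ ⊢ lt (nth l i) (sumSuc l)
  nth<sumSuc-head a l' l≐ i≐ =
    lt-cong (≐-sym (≐-trans (nth-cong l≐ i≐) (nth-cons-zero a l')))
            (≐-sym (≐-trans (app-congʳ sumSucT l≐) (sumSuc-cons a l')))
            (lt-intro _ ≐-refl)

  nth<sumSuc-tail : ∀ {Γ Δ} {l : Tm Γ (Seq 𝕆)} {i : Tm Γ 𝕆} (a : Tm Γ 𝕆) (l' : Tm Γ (Seq 𝕆)) (j : Tm Γ 𝕆) →
                    Γ ∣ Δ ⊢ l ≐ a ∷ₜ l' → Γ ∣ Δ ⊢ i ≐ S j →
                    Γ ∣ Δ ⊢ lt (nth l' j) (sumSuc l') → Γ ∣ Δ ⊢ lt (nth l i) (sumSuc l)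
  nth<sumSuc-tail a l' j l≐ i≐ p =
    lt-cong (≐-sym (≐-trans (nth-cong l≐ i≐) (nth-cons-suc a l' j)))
            (≐-sym (≐-trans (app-congʳ sumSucT l≐) (sumSuc-cons a l')))
            (lt-trans p (lt-plus-suc a (sumSuc l')))

  nth<sumSuc : ∀ {Γ Δ} (l : Tm Γ (Seq 𝕆)) (i : Tm Γ 𝕆) →
               Γ ∣ Δ ⊢ lt i (len l) → Γ ∣ Δ ⊢ lt (nth l i) (sumSuc l)
  nth<sumSuc l i =
    ⊃E (cast (subF-sub0-liftS ((var ▹ len l) ▹ l) i (lt v0 (len v1) ⊃ lt (nth v1 v0) (sumSuc v1)))
            (∀E (⊃E (∀E₂ byLength (len l) l) ≐-refl) i))
    where
    bounded : ∀ {Γ} → Fm (𝕆 ∷ Γ)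
    bounded = all (Seq 𝕆) (len v0 ≐ v1 ⊃ all 𝕆 (lt v0 (len v1) ⊃ lt (nth v1 v0) (sumSuc v1)))
    byLength : ∀ {Γ Δ} → Γ ∣ Δ ⊢ all 𝕆 bounded
    byLength = induction bounded (tt , tt , tt)
      (∀I (⊃I (∀I (⊃I (⊥E (≮zero (lt-congʳ hyp₁ hyp₀)))))))
      (∀I (⊃I (∀I (⊃I (∨E (axiom (seqCases v1))
        (⊥E (suc≢zero (≐-trans (≐-sym hyp₂) (≐-trans (len-cong hyp₀) len-nil))))
        (∃E hyp₀ (∃E hyp₀ (∨E (∀E zero-or-suc v2)
          (nth<sumSuc-head _ _ hyp₁ hyp₀)
          (∃E hyp₀ (nth<sumSuc-tail _ _ _ hyp₂ hyp₀
            (⊃E (∀E (⊃E (∀E hyp₇ v1) (len-tail _ _ hyp₂ hyp₆)) v0) (lt-len-tail _ _ hyp₂ hyp₀ hyp₅))))))))))))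

  project-embed : ∀ {Γ Δ} σ (n : Tm Γ 𝕆) → Γ ∣ Δ ⊢ app (project σ) (app (embed σ) n) ≐ n
  project-embed 𝕆 n = ≐-trans (app-congʳ (project 𝕆) (β v0 n)) (β v0 n)
  project-embed (σ ⇒ τ) n =
    ≐-trans (app-congʳ (project (σ ⇒ τ))
              (cast≐ refl (cong (λ z → lam (app z (wk n))) (sub-embed τ _)) (β _ n)))
    (≐-trans (cast≐ refl (cong₂ (λ z u → app z (app (lam (app (embed τ) (wk n))) u))
                                (sub-project τ _) (sub-zeroOf σ _))
                         (β _ _))
    (≐-trans (app-congʳ (project τ) (cast≐ refl (cong₂ app (sub-embed τ _) (sub0-wk _ n)) (β _ _)))
    (project-embed τ n)))
  project-embed (Seq σ) n =
    ≐-trans (app-congʳ (project (Seq σ))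
              (cast≐ refl (cong (λ z → app z n ∷ₜ nil σ) (sub-embed σ _)) (β _ n)))
    (≐-trans (cast≐ refl (cong (λ z → app (app (app (lrec σ 𝕆) zer) (lam (lam (lam (app z v2)))))
                                          (app (embed σ) n ∷ₜ nil σ))
                               (sub-project σ _))
                         (β _ _))
    (≐-trans (axiom (lrecCons _ _ _ _))
    (≐-trans (app-congˡ _ (app-congˡ _ (β _ _)))
    (≐-trans (app-congˡ _ (β _ _))
    (≐-trans (cast≐ refl (cong₂ app (project-eq _ _ _)
                                    (trans (cong (sub (sub0 _)) (sub-wk² _ vs (λ y → refl) (app (embed σ) n)))
                                           (sub0-wk _ _)))
                         (β _ _))
    (project-embed σ n))))))
    where
    project-eq : ∀ {Θ₁ Θ₂ Θ₃ Θ₄} (s₁ : Sub Θ₃ Θ₄) (s₂ : Sub Θ₂ Θ₃) (s₃ : Sub Θ₁ Θ₂) →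
                 sub s₁ (sub s₂ (sub s₃ (project σ))) ≡ project σ
    project-eq s₁ s₂ s₃ = trans (cong (λ z → sub s₁ (sub s₂ z)) (sub-project σ s₃))
                                (trans (cong (sub s₁) (sub-project σ s₂)) (sub-project σ s₁))

  -- Standardness

  st-app : ∀ {Γ Δ σ τ} {f : Tm Γ (σ ⇒ τ)} {x : Tm Γ σ} →
           Γ ∣ Δ ⊢ st f → Γ ∣ Δ ⊢ st x → Γ ∣ Δ ⊢ st (app f x)
  st-app {f = f} {x} p q = ⊃E (axiom (stApp f x)) (∧I p q)

  st-≐ : ∀ {Γ Δ σ} {s t : Tm Γ σ} → Γ ∣ Δ ⊢ st s → Γ ∣ Δ ⊢ s ≐ t → Γ ∣ Δ ⊢ st t
  st-≐ {s = s} {t} p q = ⊃E (axiom (stEq s t)) (∧I p q)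

  st-embed : ∀ {Γ Δ} σ → Γ ∣ Δ ⊢ st (embed σ)
  st-embed σ = cast (cong st (ren-embed σ _)) (axiom (stClosed (embed σ)))

  st-project : ∀ {Γ Δ} σ → Γ ∣ Δ ⊢ st (project σ)
  st-project σ = cast (cong st (ren-project σ _)) (axiom (stClosed (project σ)))

  st-sumSucT : ∀ {Γ Δ} → Γ ∣ Δ ⊢ st sumSucT
  st-sumSucT = axiom (stClosed sumSucT)

  st-embed⁻¹ : ∀ {Γ Δ} σ {n : Tm Γ 𝕆} → Γ ∣ Δ ⊢ st (app (embed σ) n) → Γ ∣ Δ ⊢ st n
  st-embed⁻¹ σ {n} p = st-≐ (st-app (st-project σ) p) (project-embed σ n)

  ∀ˢᵗE : ∀ {Γ Δ σ} {Φ : Fm (σ ∷ Γ)} → Γ ∣ Δ ⊢ allSt σ Φ → (t : Tm Γ σ) → Γ ∣ Δ ⊢ st t → Γ ∣ Δ ⊢ Φ [ t ]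
  ∀ˢᵗE {Φ = Φ} p t q = ⊃E (∀E (⊃E (∧E₁ (axiom (allStDef Φ))) p) t) q

  ∃ˢᵗI : ∀ {Γ Δ σ} {Φ : Fm (σ ∷ Γ)} (t : Tm Γ σ) → Γ ∣ Δ ⊢ st t → Γ ∣ Δ ⊢ Φ [ t ] → Γ ∣ Δ ⊢ exSt σ Φ
  ∃ˢᵗI {Φ = Φ} t p q = ⊃E (∧E₂ (axiom (exStDef Φ))) (∃I t (∧I p q))

  ∃ˢᵗE : ∀ {Γ Δ σ} {Φ : Fm (σ ∷ Γ)} {ψ : Fm Γ} → Γ ∣ Δ ⊢ exSt σ Φ →
         σ ∷ Γ ∣ (st v0 ∧' Φ) ∷ map wkF Δ ⊢ wkF ψ → Γ ∣ Δ ⊢ ψ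
  ∃ˢᵗE {Φ = Φ} p q = ∃E (⊃E (∧E₁ (axiom (exStDef Φ))) p) q

open Derivations base

module Underspill {Γ : Ctx} {σ : Ty} (φ : Fm (σ ∷ Γ)) (φ-internal : Internal φ) where

  premise : Fm Γ
  premise = all σ (¬' (st v0) ⊃ φ)

  φ-at : ∀ {Δ} → Sub Γ Δ → Tm Δ 𝕆 → Fm Δ
  φ-at s t = subF (s ▹ app (embed σ) t) φ

  φ-at-cong : ∀ {Δ} {s s' : Sub Γ Δ} {t t' : Tm Δ 𝕆} → s ≗ˢ s' → t ≡ t' → φ-at s t ≡ φ-at s' t'
  φ-at-cong eq refl = subF-cong (λ { vz → refl ; (vs x) → eq x }) φ

  renF-φ-at : ∀ {Δ Θ} (r : Ren Δ Θ) (s : Sub Γ Δ) (t : Tm Δ 𝕆) →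
              renF r (φ-at s t) ≡ φ-at (λ x → ren r (s x)) (ren r t)
  renF-φ-at r s t = trans (renF-subF r _ φ) (subF-cong pointwise φ)
    where
    pointwise : (λ {τ} x → ren r ((s ▹ app (embed σ) t) {τ} x))
                ≗ˢ ((λ x → ren r (s x)) ▹ app (embed σ) (ren r t))
    pointwise vz     = cong (λ e → app e (ren r t)) (ren-embed σ r)
    pointwise (vs x) = refl

  subF-φ-at : ∀ {Δ Θ} (s' : Sub Δ Θ) (s : Sub Γ Δ) (t : Tm Δ 𝕆) →
              subF s' (φ-at s t) ≡ φ-at (λ x → sub s' (s x)) (sub s' t)
  subF-φ-at s' s t = trans (subF-subF s' _ φ) (subF-cong pointwise φ)
    where
    pointwise : (λ {τ} x → sub s' ((s ▹ app (embed σ) t) {τ} x))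
                ≗ˢ ((λ x → sub s' (s x)) ▹ app (embed σ) (sub s' t))
    pointwise vz     = cong (λ e → app e (sub s' t)) (sub-embed σ s')
    pointwise (vs x) = refl

  φ∘embed : Fm (𝕆 ∷ Γ)
  φ∘embed = φ-at (λ x → var (vs x)) v0

  φ∘embed₂ : Fm (𝕆 ∷ 𝕆 ∷ 𝕆 ∷ Γ)
  φ∘embed₂ = φ-at (λ x → var (vs (vs (vs x)))) v2

  -- beyond k n  ⇔  (k ≤ n → φ (embed σ n)), with k ≤ n written as ∃j. n = k + j
  beyond : Fm (𝕆 ∷ 𝕆 ∷ Γ)
  beyond = all 𝕆 (v2 ≐ plus v1 v0 ⊃ φ∘embed₂)

  beyond-at : ∀ {Θ Δ} (ρ : Sub Γ Θ) {n k : Tm Θ 𝕆} (j : Tm Θ 𝕆) →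
              Θ ∣ Δ ⊢ subF ((ρ ▹ n) ▹ k) beyond → Θ ∣ Δ ⊢ n ≐ plus k j → Θ ∣ Δ ⊢ φ-at ρ n
  beyond-at ρ {n} {k} j p = ⊃E (cast instance-eq (∀E p j))
    where
    instance-eq : subF (liftS ((ρ ▹ n) ▹ k)) (v2 ≐ plus v1 v0 ⊃ φ∘embed₂) [ j ] ≡ (n ≐ plus k j ⊃ φ-at ρ n)
    instance-eq = cong₂ _⊃_ (cong₂ _≐_ (sub0-wk j n) (cong (λ z → plus z j) (sub0-wk j k)))
                            (trans (cong (subF (sub0 j)) (subF-φ-at (liftS ((ρ ▹ n) ▹ k)) _ v2))
                                   (trans (subF-φ-at (sub0 j) _ _)
                                          (φ-at-cong (λ x → sub0-wk j (ρ x)) (sub0-wk j n))))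

  distinct : Fm (𝕆 ∷ 𝕆 ∷ Γ)
  distinct = ¬' (v0 ≐ v1)

  hgmp-premise : 𝕆 ∷ Γ ∣ wkF premise ∷ [] ⊢ allSt 𝕆 distinct ⊃ φ∘embed
  hgmp-premise = ⊃I (cast (trans (subF-renF _ _ φ) (subF-cong (λ { vz → refl ; (vs x) → refl }) φ))
                          (⊃E (∀E hyp₁ (app (embed σ) v0)) embed-nonstandard))
    where
    embed-nonstandard : 𝕆 ∷ Γ ∣ allSt 𝕆 distinct ∷ wkF premise ∷ [] ⊢ ¬' (st (app (embed σ) v0))
    embed-nonstandard = ⊃I (⊃E (∀ˢᵗE hyp₁ v0 (st-embed⁻¹ σ hyp₀)) ≐-refl)

  hgmp-conclusion : 𝕆 ∷ Γ ∣ wkF premise ∷ [] ⊢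
                    exSt (Seq 𝕆) (allIn v0 (renF (liftR vs) distinct) ⊃ wkF φ∘embed)
  hgmp-conclusion = ⊃E (ax (HGMP distinct φ∘embed (tt , tt) (subF-internal _ φ φ-internal))) hgmp-premise

  beyond-sumSuc-∉ : ∀ {Δ} → 𝕆 ∷ Seq 𝕆 ∷ 𝕆 ∷ Γ ∣ (v2 ≐ plus (sumSuc v1) v0) ∷ Δ ⊢
                            wkF (allIn v0 (renF (liftR vs) distinct))
  beyond-sumSuc-∉ = ∀I (⊃I (⊃I (lt⇒≢plus (nth<sumSuc _ _ hyp₁) (≐-trans hyp₀ hyp₂))))

  threshold : 𝕆 ∷ Γ ∣ wkF premise ∷ [] ⊢ exSt 𝕆 beyond
  threshold = ∃ˢᵗE hgmp-conclusion
    (∃ˢᵗI (sumSuc v0) (st-app st-sumSucT (∧E₁ hyp₀))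
          (∀I (⊃I (cast φ∘embed-weakened (⊃E (∧E₂ hyp₁) beyond-sumSuc-∉)))))
    where
    φ∘embed-weakened : renF vs (renF vs φ∘embed)
                       ≡ subF (liftS (sub0 (sumSuc v0))) (renF (liftR (liftR vs)) φ∘embed₂)
    φ∘embed-weakened =
      trans (trans (cong (renF vs) (renF-φ-at vs _ v0)) (renF-φ-at vs _ v1))
            (sym (trans (cong (subF _) (renF-φ-at _ _ v2)) (subF-φ-at _ _ _)))

  thresholds : Γ ∣ premise ∷ [] ⊢ exSt (Seq 𝕆) (all 𝕆 (exIn v1 (renF (liftR (liftR vs)) beyond)))
  thresholds = ⊃E (ax (R beyond (tt , subF-internal _ φ φ-internal))) (∀I threshold)

  underspill : Γ ∣ premise ∷ [] ⊢ exSt σ φ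
  underspill = ∃ˢᵗE thresholds
    (∃E (∀E (∧E₂ hyp₀) (sumSuc v0))
      (∃E (nth<sumSuc v1 v0 (∧E₁ hyp₀))
        (∃ˢᵗI (app (embed σ) (sumSuc v2)) (st-app (st-embed σ) (st-app st-sumSucT (∧E₁ hyp₂)))
              (cast φ-at-weakened³
                (beyond-at (λ x → var (vs (vs (vs x)))) (S v0)
                           (cast beyond-weakened (∧E₂ hyp₁)) (≐-sym hyp₀))))))
    where
    beyond-weakened : renF vs (subF (liftS (sub0 (sumSuc v0))) (atIndex v1 (renF (liftR (liftR vs)) beyond)))
                      ≡ subF (((λ x → var (vs (vs (vs x)))) ▹ sumSuc v2) ▹ nth v2 v1) beyond
    beyond-weakened =
      trans (cong (renF vs) (trans (cong (subF _) (subF-renF _ _ beyond)) (subF-subF _ _ beyond)))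
            (trans (renF-subF vs _ beyond)
                   (subF-cong (λ { vz → refl ; (vs vz) → refl ; (vs (vs x)) → refl }) beyond))
    φ-at-weakened³ : φ-at (λ x → var (vs (vs (vs x)))) (sumSuc v2)
                     ≡ renF (liftR vs) (renF (liftR vs) (renF (liftR vs) φ)) [ app (embed σ) (sumSuc v2) ]
    φ-at-weakened³ =
      sym (trans (subF-renF _ _ _) (trans (subF-renF _ _ _) (trans (subF-renF _ _ _)
        (subF-cong (λ { vz → refl ; (vs x) → refl }) φ))))

mainTheorem11 : ∀ {Γ : Ctx} {σ : Ty} (φ : Fm (σ ∷ Γ)) → Internal φ → Γ ⊢RH US-ax φ
mainTheorem11 φ iφ = ⊃I (Underspill.underspill φ iφ)
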